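{- For every vertex $v$ of $C(m,n)$, the point $(\mathbf{x},\mathbf{y})_v=(x_1,\dots,x_{m-1},y_1,\dots,y_{n-1})$ satisfies $$\sum_{i=1}^{m-1}x_i+\sum_{j=1}^{n-1}y_j=\binom{n}{2}\binom{m}{2}+\binom{n}{2}+\binom{m}{2}.$$
   Context: Fix positive integers $m,n$. $\mathsf{Coll}(m,n)$ is the set of formal symbols $m_1,\dots,m_{m-1}$ ($m_j$ = collision of vertical lines $M_j,M_{j+1}$) and $l_1,\dots,l_{n-1}$ ($l_i$ = collision of horizontal lines $L_i,L_{i+1}$). A preorder is a reflexive transitive relation $\le$; $x\equiv y$ means $x\le y$ and $y\le x$, $x<y$ means $x\le y$ but not $y\le x$, and $x,y$ are comparable if $x\le y$ or $y\le x$. Pairs $\{m_j,l_i\}$ are orthogonal; $\{m_j,m_{j'}\}$ and $\{l_i,l_{i'}\}$ are parallel. Given a preorder, an orthogonal link between parallel $m_i,m_j$ is an $l_s$ with $m_i\le l_s\le m_j$ or $m_j\le l_s\le m_i$; a gap between $m_i,m_j$ is an $m_s$ with $s$ between $i$ and $j$ inclusive and $m_i<m_s$, $m_j<m_s$; symmetrically for $l$'s. A preorder is good rectangular if (1) orthogonal collisions are always comparable and (2) parallel collisions are comparable iff there is an orthogonal link between them or no gap between them. $C(m,n)$ is the set of good rectangular preorders; a vertex is one in which $x\equiv y$ implies $x=y$. Coordinates of a vertex $v$ (comparisons in $v$): $y_i=W_1W_2T$ ($1\le i\le n-1$) with $W_1=i-p+1$ where $p$ is smallest such that $l_k<l_i$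 for all $p\le k<i$; $W_2=q-i$ where $q\le n$ is largest such that $l_k<l_i$ for all $i<k<q$; $T=1+\#\{(a,b):1\le a<b\le m,\ m_k<l_i\ \forall\, a\le k<b\}$. Symmetrically $x_j=W_1W_2T$ ($1\le j\le m-1$) with $W_1=j-p+1$, $p$ smallest with $m_k<m_j$ for $p\le k<j$; $W_2=q-j$, $q\le m$ largest with $m_k<m_j$ for $j<k<q$; $T=1+\#\{(a,b):1\le a<b\le n,\ l_k<m_j\ \forall\, a\le k<b\}$. -}

module Defs where

open import Data.Nat using (ℕ; zero; suc; _+_; _*_; _∸_; _≤_; _<_; _<ᵇ_)
open import Data.Nat.Properties using (_<?_)
open import Data.Fin using (Fin; fromℕ<)
open import Data.Sum using (_⊎_; inj₁; inj₂)
open import Data.Product using (_×_; Σ; ∃; ∃-syntax; _,_)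
open import Data.Bool using (Bool; true; false; T; _∧_; not)
open import Data.Maybe using (Maybe; just; nothing)
open import Data.List using (List; []; _∷_; map; filter; length; concatMap; upTo)
open import Data.Bool.ListAction using (and)
open import Data.Nat.ListAction using (sum)
open import Relation.Nullary using (¬_; yes; no)
open import Relation.Binary.PropositionalEquality using (_≡_)
open import Function.Bundles using (_⇔_)

-- Collisions.  We write m = suc m' and n = suc n' (m, n positive).
-- inj₁ j  (j : Fin m')  is the vertical collision   m_{j+1}
-- inj₂ i  (i : Fin n')  is the horizontal collision l_{i+1}

Coll : ℕ → ℕ → Set
Coll m' n' = Fin m' ⊎ Fin n'

Rel : ℕ → ℕ → Set
Rel m' n' = Coll m' n' → Coll m' n' → Bool

module _ {m' n' : ℕ} (R : Rel m' n') where

  _≼_ : Coll m' n' → Coll m' n' → Set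
  x ≼ y = T (R x y)

  _≺_ : Coll m' n' → Coll m' n' → Set
  x ≺ y = x ≼ y × ¬ (y ≼ x)

  Comparable : Coll m' n' → Coll m' n' → Set
  Comparable x y = x ≼ y ⊎ y ≼ x

  IsPreorder : Set
  IsPreorder = (∀ x → x ≼ x) × (∀ x y z → x ≼ y → y ≼ z → x ≼ z)

  VLink : Fin m' → Fin m' → Set
  VLink i j = ∃[ s ] ((inj₁ i ≼ inj₂ s × inj₂ s ≼ inj₁ j) ⊎ (inj₁ j ≼ inj₂ s × inj₂ s ≼ inj₁ i))

  HLink : Fin n' → Fin n' → Set
  HLink i j = ∃[ s ] ((inj₂ i ≼ inj₁ s × inj₁ s ≼ inj₂ j) ⊎ (inj₂ j ≼ inj₁ s × inj₁ s ≼ inj₂ i))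

  Between : ∀ {k} → Fin k → Fin k → Fin k → Set
  Between i j s = (Data.Fin.toℕ i ≤ Data.Fin.toℕ s × Data.Fin.toℕ s ≤ Data.Fin.toℕ j)
                ⊎ (Data.Fin.toℕ j ≤ Data.Fin.toℕ s × Data.Fin.toℕ s ≤ Data.Fin.toℕ i)

  VGap : Fin m' → Fin m' → Set
  VGap i j = ∃[ s ] (Between i j s × inj₁ i ≺ inj₁ s × inj₁ j ≺ inj₁ s)

  HGap : Fin n' → Fin n' → Set
  HGap i j = ∃[ s ] (Between i j s × inj₂ i ≺ inj₂ s × inj₂ j ≺ inj₂ s)

  IsGoodRectangular : Set
  IsGoodRectangular =
      IsPreorder
    × (∀ (j : Fin m') (i : Fin n') → Comparable (inj₁ j) (inj₂ i))
    × (∀ (i j : Fin m') → Comparable (inj₁ i) (inj₁ j) ⇔ (VLink i j ⊎ ¬ VGap i j))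
    × (∀ (i j : Fin n') → Comparable (inj₂ i) (inj₂ j) ⇔ (HLink i j ⊎ ¬ HGap i j))

  IsVertex : Set
  IsVertex = IsGoodRectangular × (∀ x y → x ≼ y → y ≼ x → x ≡ y)

  -- Coordinates, with 1-based natural-number indices as in the paper.

  ltB : Coll m' n' → Coll m' n' → Bool
  ltB x y = R x y ∧ not (R y x)

  fin1 : (k : ℕ) → ℕ → Maybe (Fin k)
  fin1 k zero = nothing
  fin1 k (suc j) with j <? k
  ... | yes p = just (fromℕ< p)
  ... | no _  = nothing

  vert : ℕ → Maybe (Coll m' n')
  vert j = Data.Maybe.map inj₁ (fin1 m' j)

  horiz : ℕ → Maybe (Coll m' n')
  horiz i = Data.Maybe.map inj₂ (fin1 n' i)

  ltM : Maybe (Coll m' n') → Maybe (Coll m' n') → Bool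
  ltM (just x) (just y) = ltB x y
  ltM _ _ = false

  range : ℕ → ℕ → List ℕ
  range a b = map (a +_) (upTo (b ∸ a))

  rangeI : ℕ → ℕ → List ℕ
  rangeI a b = range a (suc b)

  firstOr : (ℕ → Bool) → ℕ → List ℕ → ℕ
  firstOr P d [] = d
  firstOr P d (x ∷ xs) with P x
  ... | true  = x
  ... | false = firstOr P d xs

  reverse' : List ℕ → List ℕ
  reverse' = Data.List.reverse

  -- generic coordinate: par = same-direction collisions, N = number of
  -- parallel lines (so par indices 1..N-1), orth = orthogonal collisions,
  -- M = number of orthogonal lines.
  coord : (ℕ → Maybe (Coll m' n')) → ℕ → (ℕ → Maybe (Coll m' n')) → ℕ → ℕ → ℕ
  coord par N orth M i = W1 * W2 * Tc
    where
    below : ℕ → Bool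
    below k = ltM (par k) (par i)
    -- smallest p (1 ≤ p ≤ i) with l_k < l_i for all p ≤ k < i
    p : ℕ
    p = firstOr (λ p → and (map below (range p i))) i (rangeI 1 i)
    -- largest q ≤ N (q ≥ i+1) with l_k < l_i for all i < k < q
    q : ℕ
    q = firstOr (λ q → and (map below (range (suc i) q))) (suc i) (reverse' (rangeI (suc i) N))
    W1 W2 Tc : ℕ
    W1 = i ∸ p + 1
    W2 = q ∸ i
    pairs : List (ℕ × ℕ)
    pairs = concatMap (λ a → map (a ,_) (rangeI (suc a) M)) (rangeI 1 M)
    good : ℕ × ℕ → Bool
    good (a , b) = and (map (λ k → ltM (orth k) (par i)) (range a b))
    Tc = 1 + length (filter (λ ab → good ab Data.Bool.≟ true) pairs)

  xCoord : ℕ → ℕ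
  xCoord j = coord vert (suc m') horiz (suc n') j

  yCoord : ℕ → ℕ
  yCoord i = coord horiz (suc n') vert (suc m') i

  coordSum : ℕ
  coordSum = sum (map xCoord (rangeI 1 m')) + sum (map yCoord (rangeI 1 n'))

{-# OPTIONS --safe #-}
-- In a vertex, every interval [a, b) of consecutive parallel collisions has a unique strict
-- maximum: the running maximum of [a, c) dominates everything strictly between it and c, so
-- there is no gap between the two and they are comparable. The factor W₁ W₂ of a coordinate
-- counts the intervals whose maximum is that collision, and T − 1 counts the orthogonal
-- intervals lying entirely below it, i.e. whose maximum lies below it. Hence the x-coordinates
-- sum to C(m,2) plus the number of pairs (I, J) of a vertical and a horizontal interval with
-- max J < max I, and the y-coordinates symmetrically. Orthogonal collisions are comparable and
-- distinct, so each of the C(n,2) C(m,2) pairs is counted exactly once.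
module Submission where

open import Defs
open import Data.Nat
open import Data.Nat.Properties
open import Data.Nat.Combinatorics using (_C_; nC1≡n; nCk+nC[k+1]≡[n+1]C[k+1])
open import Data.Nat.ListAction using (sum)
open import Data.Nat.ListAction.Properties using (sum-++)
open import Data.Nat.Tactic.RingSolver using (solve-∀)
open import Data.Bool as Bool using (Bool; true; false; T; _∧_; if_then_else_)
open import Data.Bool.Properties using (T-≡; T-∧)
open import Data.Bool.ListAction using (all)
open import Data.List using (List; []; _∷_; _++_; [_]; _∷ʳ_; map; concatMap; filter; length; reverse; upTo)
open import Data.List.Properties using (map-++; map-∘; length-map; length-upTo; upTo-∷ʳ; reverse-++; ++-assoc; ++-identityʳ)
open import Data.List.Membership.Propositional using (_∈_)
open import Data.List.Membership.Propositional.Properties using (∈-map⁺; ∈-map⁻; ∈-upTo⁺; ∈-upTo⁻; ∈-concat⁻′)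
open import Data.List.Relation.Unary.Any using (here; there)
open import Data.List.Relation.Unary.All as All using (All)
open import Data.List.Relation.Unary.All.Properties using (all⁺; all⁻)
open import Data.Product using (_×_; _,_; ∃-syntax; proj₁; proj₂)
open import Data.Sum as Sum using (_⊎_; inj₁; inj₂)
open import Data.Sum.Properties using (inj₁-injective; inj₂-injective)
open import Data.Maybe as Maybe using (Maybe; just)
open import Data.Fin using (Fin; toℕ; fromℕ<)
open import Data.Fin.Properties using (toℕ-injective; toℕ<n; toℕ-fromℕ<; fromℕ<-toℕ)
open import Data.Empty using (⊥-elim)
open import Function using (_∘_)
open import Function.Bundles using (Equivalence; _⇔_)
open import Relation.Nullary using (¬_; yes; no)
open import Relation.Nullary.Decidable using (T?)
open import Relation.Binary.Definitions using (tri<; tri≈; tri>)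
open import Relation.Binary.PropositionalEquality hiding ([_])
open ≡-Reasoning

private
  variable
    A B : Set
    a b c x : ℕ

∑ : List A → (A → ℕ) → ℕ
∑ xs f = sum (map f xs)

∑-cong : ∀ (xs : List A) {f g : A → ℕ} → (∀ {x} → x ∈ xs → f x ≡ g x) → ∑ xs f ≡ ∑ xs g
∑-cong []       f≗g = refl
∑-cong (x ∷ xs) f≗g = cong₂ _+_ (f≗g (here refl)) (∑-cong xs (f≗g ∘ there))

∑-++ : ∀ (xs ys : List A) (f : A → ℕ) → ∑ (xs ++ ys) f ≡ ∑ xs f + ∑ ys f
∑-++ xs ys f = trans (cong sum (map-++ f xs ys)) (sum-++ (map f xs) (map f ys))

∑-map : ∀ (xs : List A) (h : A → B) (f : B → ℕ) → ∑ (map h xs) f ≡ ∑ xs (f ∘ h)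
∑-map xs h f = cong sum (sym (map-∘ xs))

∑-concatMap : ∀ (xs : List A) (h : A → List B) (f : B → ℕ) →
  ∑ (concatMap h xs) f ≡ ∑ xs (λ x → ∑ (h x) f)
∑-concatMap []       h f = refl
∑-concatMap (x ∷ xs) h f =
  trans (∑-++ (h x) (concatMap h xs) f) (cong (∑ (h x) f +_) (∑-concatMap xs h f))

∑-zero : ∀ (xs : List A) → ∑ xs (λ _ → 0) ≡ 0
∑-zero []       = refl
∑-zero (x ∷ xs) = ∑-zero xs

∑-one : ∀ (xs : List A) → ∑ xs (λ _ → 1) ≡ length xs
∑-one []       = refl
∑-one (x ∷ xs) = cong suc (∑-one xs)

∑-const : ∀ (xs : List A) k → ∑ xs (λ _ → k) ≡ length xs * k
∑-const []       k = refl
∑-const (x ∷ xs) k = cong (k +_) (∑-const xs k)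

∑-+ : ∀ (xs : List A) (f g : A → ℕ) → ∑ xs (λ x → f x + g x) ≡ ∑ xs f + ∑ xs g
∑-+ []       f g = refl
∑-+ (x ∷ xs) f g = begin
  f x + g x + ∑ xs (λ x → f x + g x) ≡⟨ cong (f x + g x +_) (∑-+ xs f g) ⟩
  f x + g x + (∑ xs f + ∑ xs g)      ≡⟨ interchange (f x) (g x) (∑ xs f) (∑ xs g) ⟩
  f x + ∑ xs f + (g x + ∑ xs g)      ∎
  where
  interchange : ∀ p q r s → p + q + (r + s) ≡ p + r + (q + s)
  interchange = solve-∀

∑-*ˡ : ∀ (xs : List A) (k : ℕ) (f : A → ℕ) → k * ∑ xs f ≡ ∑ xs (λ x → k * f x)
∑-*ˡ []       k f = *-zeroʳ k
∑-*ˡ (x ∷ xs) k f = trans (*-distribˡ-+ k (f x) (∑ xs f)) (cong (k * f x +_) (∑-*ˡ xs k f))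

∑-*ʳ : ∀ (xs : List A) (k : ℕ) (f : A → ℕ) → ∑ xs f * k ≡ ∑ xs (λ x → f x * k)
∑-*ʳ xs k f = begin
  ∑ xs f * k              ≡⟨ *-comm (∑ xs f) k ⟩
  k * ∑ xs f              ≡⟨ ∑-*ˡ xs k f ⟩
  ∑ xs (λ x → k * f x)    ≡⟨ ∑-cong xs (λ {x} _ → *-comm k (f x)) ⟩
  ∑ xs (λ x → f x * k)    ∎

∑-comm : ∀ (xs : List A) (ys : List B) (f : A → B → ℕ) →
  ∑ xs (λ x → ∑ ys (f x)) ≡ ∑ ys (λ y → ∑ xs (λ x → f x y))
∑-comm []       ys f = sym (∑-zero ys)
∑-comm (x ∷ xs) ys f = begin
  ∑ ys (f x) + ∑ xs (λ x → ∑ ys (f x))               ≡⟨ cong (∑ ys (f x) +_) (∑-comm xs ys f) ⟩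
  ∑ ys (f x) + ∑ ys (λ y → ∑ xs (λ x → f x y))      ≡⟨ ∑-+ ys (f x) (λ y → ∑ xs (λ x → f x y)) ⟨
  ∑ ys (λ y → f x y + ∑ xs (λ x → f x y))           ∎

∑-complementary : ∀ (Is : List A) (Js : List B) (X : B → A → ℕ) (Y : A → B → ℕ) →
  (∀ {I J} → I ∈ Is → J ∈ Js → X J I + Y I J ≡ 1) →
  ∑ Js (λ J → 1 + ∑ Is (X J)) + ∑ Is (λ I → 1 + ∑ Js (Y I)) ≡ length Is * length Js + length Is + length Js
∑-complementary Is Js X Y X+Y≡1 = begin
  ∑ Js (λ J → 1 + ∑ Is (X J)) + ∑ Is (λ I → 1 + ∑ Js (Y I))
    ≡⟨ cong₂ _+_ (∑-+ Js (λ _ → 1) (λ J → ∑ Is (X J))) (∑-+ Is (λ _ → 1) (λ I → ∑ Js (Y I))) ⟩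
  (∑ Js (λ _ → 1) + ∑ Js (λ J → ∑ Is (X J))) + (∑ Is (λ _ → 1) + ∑ Is (λ I → ∑ Js (Y I)))
    ≡⟨ rearrange (∑ Js (λ _ → 1)) (∑ Js (λ J → ∑ Is (X J))) (∑ Is (λ _ → 1)) (∑ Is (λ I → ∑ Js (Y I))) ⟩
  (∑ Js (λ J → ∑ Is (X J)) + ∑ Is (λ I → ∑ Js (Y I))) + ∑ Is (λ _ → 1) + ∑ Js (λ _ → 1)
    ≡⟨ cong₂ (λ p q → p + q + ∑ Js (λ _ → 1)) crossing (∑-one Is) ⟩
  length Is * length Js + length Is + ∑ Js (λ _ → 1)
    ≡⟨ cong (length Is * length Js + length Is +_) (∑-one Js) ⟩
  length Is * length Js + length Is + length Js ∎
  where
  rearrange : ∀ p q r s → (p + q) + (r + s) ≡ (q + s) + r + p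
  rearrange = solve-∀
  crossing : ∑ Js (λ J → ∑ Is (X J)) + ∑ Is (λ I → ∑ Js (Y I)) ≡ length Is * length Js
  crossing = begin
    ∑ Js (λ J → ∑ Is (X J)) + ∑ Is (λ I → ∑ Js (Y I))
      ≡⟨ cong (_+ ∑ Is (λ I → ∑ Js (Y I))) (∑-comm Js Is X) ⟩
    ∑ Is (λ I → ∑ Js (λ J → X J I)) + ∑ Is (λ I → ∑ Js (Y I))
      ≡⟨ ∑-+ Is (λ I → ∑ Js (λ J → X J I)) (λ I → ∑ Js (Y I)) ⟨
    ∑ Is (λ I → ∑ Js (λ J → X J I) + ∑ Js (Y I))
      ≡⟨ ∑-cong Is (λ {I} _ → sym (∑-+ Js (λ J → X J I) (Y I))) ⟩
    ∑ Is (λ I → ∑ Js (λ J → X J I + Y I J))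
      ≡⟨ ∑-cong Is (λ I∈ → ∑-cong Js (λ J∈ → X+Y≡1 I∈ J∈)) ⟩
    ∑ Is (λ _ → ∑ Js (λ _ → 1))     ≡⟨ ∑-const Is (∑ Js (λ _ → 1)) ⟩
    length Is * ∑ Js (λ _ → 1)       ≡⟨ cong (length Is *_) (∑-one Js) ⟩
    length Is * length Js            ∎

bit : Bool → ℕ
bit true  = 1
bit false = 0

bit-T : ∀ {p} → T p → bit p ≡ 1
bit-T {true} _ = refl

bit-¬T : ∀ {p} → ¬ T p → bit p ≡ 0
bit-¬T {true}  ¬p = ⊥-elim (¬p _)
bit-¬T {false} _  = refl

bit-cong : ∀ {p q} → (T p → T q) → (T q → T p) → bit p ≡ bit q
bit-cong {false} {false} _   _   = refl
bit-cong {false} {true}  _   q⇒p = ⊥-elim (q⇒p _)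
bit-cong {true}  {false} p⇒q _   = ⊥-elim (p⇒q _)
bit-cong {true}  {true}  _   _   = refl

bit-exclusive : ∀ {p q} → T p ⊎ T q → ¬ (T p × T q) → bit p + bit q ≡ 1
bit-exclusive {true}  {false} _ _ = refl
bit-exclusive {false} {true}  _ _ = refl
bit-exclusive {true}  {true}  _ ¬both = ⊥-elim (¬both (_ , _))
bit-exclusive {false} {false} (inj₁ ()) _
bit-exclusive {false} {false} (inj₂ ()) _

bit-∧ : ∀ p q → bit (p ∧ q) ≡ bit p * bit q
bit-∧ true  q = sym (+-identityʳ (bit q))
bit-∧ false q = refl

count : (A → Bool) → List A → ℕ
count p xs = ∑ xs (bit ∘ p)

length-filter : ∀ (p : A → Bool) xs → length (filter (λ x → p x Bool.≟ true) xs) ≡ count p xs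
length-filter p []       = refl
length-filter p (x ∷ xs) with p x
... | true  = cong suc (length-filter p xs)
... | false = length-filter p xs

count-all : ∀ (p : A → Bool) xs → All (T ∘ p) xs → count p xs ≡ length xs
count-all p xs ps = trans (∑-cong xs (λ x∈xs → bit-T (All.lookup ps x∈xs))) (∑-one xs)

-- Defs.range, which ignores its relation argument.
interval : ℕ → ℕ → List ℕ
interval a b = map (a +_) (upTo (b ∸ a))

∈-interval⁻ : x ∈ interval a b → a ≤ x × x < b
∈-interval⁻ {x} {a} {b} x∈ with ∈-map⁻ (a +_) x∈
... | k , k∈ , refl = m≤m+n a k , a+k<b
  where
  k<b∸a : k < b ∸ a
  k<b∸a = ∈-upTo⁻ k∈
  a+k<b : a + k < b
  a+k<b = subst (a + k <_) (m+[n∸m]≡n {a} (<⇒≤ (m∸n≢0⇒n<m (m<n⇒n≢0 k<b∸a)))) (+-monoʳ-< a k<b∸a)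

∈-interval⁺ : a ≤ x → x < b → x ∈ interval a b
∈-interval⁺ {a} {x} {b} a≤x x<b =
  subst (_∈ interval a b) (m+[n∸m]≡n a≤x) (∈-map⁺ (a +_) (∈-upTo⁺ (∸-monoˡ-< x<b a≤x)))

interval-empty : ∀ a → interval a a ≡ []
interval-empty a = cong (map (a +_) ∘ upTo) (n∸n≡0 a)

interval-∷ʳ : a ≤ b → interval a (suc b) ≡ interval a b ∷ʳ b
interval-∷ʳ {a} {b} a≤b = begin
  map (a +_) (upTo (suc b ∸ a))            ≡⟨ cong (map (a +_) ∘ upTo) (+-∸-assoc 1 a≤b) ⟩
  map (a +_) (upTo (suc (b ∸ a)))          ≡⟨ cong (map (a +_)) (upTo-∷ʳ (b ∸ a)) ⟨
  map (a +_) (upTo (b ∸ a) ∷ʳ (b ∸ a))     ≡⟨ map-++ (a +_) (upTo (b ∸ a)) [ b ∸ a ] ⟩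
  interval a b ∷ʳ (a + (b ∸ a))            ≡⟨ cong (interval a b ∷ʳ_) (m+[n∸m]≡n a≤b) ⟩
  interval a b ∷ʳ b                        ∎

interval-++ : a ≤ b → b ≤ c → interval a b ++ interval b c ≡ interval a c
interval-++ {a} {b} {c} a≤b b≤c with m≤n⇒m<n∨m≡n b≤c
... | inj₂ refl = trans (cong (interval a b ++_) (interval-empty b)) (++-identityʳ (interval a b))
interval-++ {a} {b} {suc c} a≤b b≤c | inj₁ (s≤s b≤c') = begin
  interval a b ++ interval b (suc c)        ≡⟨ cong (interval a b ++_) (interval-∷ʳ b≤c') ⟩
  interval a b ++ (interval b c ∷ʳ c)       ≡⟨ ++-assoc (interval a b) (interval b c) [ c ] ⟨
  (interval a b ++ interval b c) ∷ʳ c       ≡⟨ cong (_∷ʳ c) (interval-++ a≤b b≤c') ⟩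
  interval a c ∷ʳ c                         ≡⟨ interval-∷ʳ (≤-trans a≤b b≤c') ⟨
  interval a (suc c)                        ∎

interval-singleton : ∀ a → interval a (suc a) ≡ [ a ]
interval-singleton a = trans (interval-∷ʳ ≤-refl) (cong (_∷ʳ a) (interval-empty a))

interval-∷ : a < b → interval a b ≡ a ∷ interval (suc a) b
interval-∷ {a} {b} a<b = begin
  interval a b                              ≡⟨ interval-++ (n≤1+n a) a<b ⟨
  interval a (suc a) ++ interval (suc a) b  ≡⟨ cong (_++ interval (suc a) b) (interval-singleton a) ⟩
  a ∷ interval (suc a) b                    ∎

reverse-interval : a ≤ b → reverse (interval a (suc b)) ≡ b ∷ reverse (interval a b)
reverse-interval {a} {b} a≤b = trans (cong reverse (interval-∷ʳ a≤b)) (reverse-++ (interval a b) [ b ])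

length-interval : ∀ a b → length (interval a b) ≡ b ∸ a
length-interval a b = trans (length-map (a +_) (upTo (b ∸ a))) (length-upTo (b ∸ a))

∑-interval-cong : ∀ a b {f g : ℕ → ℕ} → (∀ {x} → a ≤ x → x < b → f x ≡ g x) →
  ∑ (interval a b) f ≡ ∑ (interval a b) g
∑-interval-cong a b f≗g = ∑-cong (interval a b) (λ x∈ → f≗g (proj₁ (∈-interval⁻ x∈)) (proj₂ (∈-interval⁻ x∈)))

∑-interval-split : a ≤ b → b ≤ c → ∀ f → ∑ (interval a c) f ≡ ∑ (interval a b) f + ∑ (interval b c) f
∑-interval-split {a} {b} {c} a≤b b≤c f =
  trans (cong (λ xs → ∑ xs f) (sym (interval-++ a≤b b≤c))) (∑-++ (interval a b) (interval b c) f)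

∑-interval-vanishʳ : a ≤ c → c ≤ b → ∀ f → (∀ {x} → c ≤ x → x < b → f x ≡ 0) →
  ∑ (interval a b) f ≡ ∑ (interval a c) f
∑-interval-vanishʳ {a} {c} {b} a≤c c≤b f f≡0 = begin
  ∑ (interval a b) f                       ≡⟨ ∑-interval-split a≤c c≤b f ⟩
  ∑ (interval a c) f + ∑ (interval c b) f  ≡⟨ cong (∑ (interval a c) f +_) vanishes ⟩
  ∑ (interval a c) f + 0                   ≡⟨ +-identityʳ _ ⟩
  ∑ (interval a c) f                       ∎
  where
  vanishes : ∑ (interval c b) f ≡ 0
  vanishes = trans (∑-interval-cong c b f≡0) (∑-zero (interval c b))

∑-interval-vanishˡ : a ≤ c → c ≤ b → ∀ f → (∀ {x} → a ≤ x → x < c → f x ≡ 0) →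
  ∑ (interval a b) f ≡ ∑ (interval c b) f
∑-interval-vanishˡ {a} {c} {b} a≤c c≤b f f≡0 = begin
  ∑ (interval a b) f                       ≡⟨ ∑-interval-split a≤c c≤b f ⟩
  ∑ (interval a c) f + ∑ (interval c b) f  ≡⟨ cong (_+ ∑ (interval c b) f) vanishes ⟩
  ∑ (interval c b) f                       ∎
  where
  vanishes : ∑ (interval a c) f ≡ 0
  vanishes = trans (∑-interval-cong a c f≡0) (∑-zero (interval a c))

∑-interval-single : a ≤ c → c < b → ∀ f → (∀ {x} → a ≤ x → x < b → x ≢ c → f x ≡ 0) →
  ∑ (interval a b) f ≡ f c
∑-interval-single {a} {c} {b} a≤c c<b f f≡0 = begin
  ∑ (interval a b) f
    ≡⟨ ∑-interval-vanishʳ (m≤n⇒m≤1+n a≤c) c<b f (λ c<x x<b → f≡0 (≤-trans a≤c (<⇒≤ c<x)) x<b (>⇒≢ c<x)) ⟩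
  ∑ (interval a (suc c)) f
    ≡⟨ ∑-interval-vanishˡ a≤c (n≤1+n c) f (λ a≤x x<c → f≡0 a≤x (<-trans x<c c<b) (<⇒≢ x<c)) ⟩
  ∑ (interval c (suc c)) f    ≡⟨ cong (λ xs → ∑ xs f) (interval-singleton c) ⟩
  f c + 0                     ≡⟨ +-identityʳ (f c) ⟩
  f c                         ∎

all-interval⁺ : ∀ (p : ℕ → Bool) a b → T (all p (interval a b)) → a ≤ x → x < b → T (p x)
all-interval⁺ p a b all-p a≤x x<b = All.lookup (all⁺ p (interval a b) all-p) (∈-interval⁺ a≤x x<b)

all-interval⁻ : ∀ (p : ℕ → Bool) a b → (∀ {x} → a ≤ x → x < b → T (p x)) → T (all p (interval a b))
all-interval⁻ p a b ps =
  all⁻ p (All.tabulate (λ x∈ → ps (proj₁ (∈-interval⁻ x∈)) (proj₂ (∈-interval⁻ x∈))))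

-- The intervals [a, b) with 1 ≤ a < b ≤ K, enumerated as in Defs.coord.
pairs : ℕ → List (ℕ × ℕ)
pairs K = concatMap (λ a → map (a ,_) (interval (suc a) (suc K))) (interval 1 (suc K))

∈-pairs⁻ : ∀ {K a b} → (a , b) ∈ pairs K → 1 ≤ a × a < b × b ≤ K
∈-pairs⁻ {K} ab∈ with ∈-concat⁻′ (map (λ a → map (a ,_) (interval (suc a) (suc K))) (interval 1 (suc K))) ab∈
... | _ , ab∈row , row∈ with ∈-map⁻ (λ a → map (a ,_) (interval (suc a) (suc K))) row∈
... | a , a∈ , refl with ∈-map⁻ (a ,_) ab∈row
... | b , b∈ , refl =
  let 1≤a , _ = ∈-interval⁻ {b = suc K} a∈
      a<b , b≤K = ∈-interval⁻ {b = suc K} b∈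
  in 1≤a , a<b , ≤-pred b≤K

∑-pairs-cong : ∀ K {F G : ℕ × ℕ → ℕ} → (∀ {a b} → 1 ≤ a → a < b → b ≤ K → F (a , b) ≡ G (a , b)) →
  ∑ (pairs K) F ≡ ∑ (pairs K) G
∑-pairs-cong K F≗G = ∑-cong (pairs K) λ ab∈ → let 1≤a , a<b , b≤K = ∈-pairs⁻ ab∈ in F≗G 1≤a a<b b≤K

∑-pairs : ∀ K (F : ℕ × ℕ → ℕ) →
  ∑ (pairs K) F ≡ ∑ (interval 1 (suc K)) (λ a → ∑ (interval (suc a) (suc K)) (λ b → F (a , b)))
∑-pairs K F = trans (∑-concatMap (interval 1 (suc K)) _ F)
  (∑-cong (interval 1 (suc K)) (λ {a} _ → ∑-map (interval (suc a) (suc K)) (a ,_) F))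

∑-interval-∸ : ∀ K → ∑ (interval 1 (suc K)) (K ∸_) ≡ K C 2
∑-interval-∸ zero    = refl
∑-interval-∸ (suc K) = begin
  ∑ (interval 1 (2 + K)) (suc K ∸_)
    ≡⟨ cong (λ xs → ∑ xs (suc K ∸_)) (interval-∷ʳ {1} {suc K} (s≤s z≤n)) ⟩
  ∑ (interval 1 (suc K) ∷ʳ suc K) (suc K ∸_)            ≡⟨ ∑-++ (interval 1 (suc K)) [ suc K ] (suc K ∸_) ⟩
  ∑ (interval 1 (suc K)) (suc K ∸_) + (suc K ∸ suc K + 0) ≡⟨ cong₂ _+_ shift (cong (_+ 0) (n∸n≡0 K)) ⟩
  ∑ (interval 1 (suc K)) (λ a → 1 + (K ∸ a)) + 0       ≡⟨ +-identityʳ _ ⟩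
  ∑ (interval 1 (suc K)) (λ a → 1 + (K ∸ a))           ≡⟨ ∑-+ (interval 1 (suc K)) (λ _ → 1) (K ∸_) ⟩
  ∑ (interval 1 (suc K)) (λ _ → 1) + ∑ (interval 1 (suc K)) (K ∸_)
    ≡⟨ cong₂ _+_ (trans (∑-one (interval 1 (suc K))) (length-interval 1 (suc K))) (∑-interval-∸ K) ⟩
  K + K C 2                                              ≡⟨ cong (_+ K C 2) (nC1≡n K) ⟨
  K C 1 + K C 2                                          ≡⟨ nCk+nC[k+1]≡[n+1]C[k+1] K 1 ⟩
  suc K C 2                                              ∎
  where
  shift : ∑ (interval 1 (suc K)) (suc K ∸_) ≡ ∑ (interval 1 (suc K)) (λ a → 1 + (K ∸ a))
  shift = ∑-interval-cong 1 (suc K) (λ _ a≤K → +-∸-assoc 1 (≤-pred a≤K))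

length-pairs : ∀ K → length (pairs K) ≡ K C 2
length-pairs K = begin
  length (pairs K)                                          ≡⟨ ∑-one (pairs K) ⟨
  ∑ (pairs K) (λ _ → 1)                                     ≡⟨ ∑-pairs K (λ _ → 1) ⟩
  ∑ (interval 1 (suc K)) (λ a → ∑ (interval (suc a) (suc K)) (λ _ → 1))
      ≡⟨ ∑-cong (interval 1 (suc K)) (λ {a} _ → trans (∑-one (interval (suc a) (suc K))) (length-interval (suc a) (suc K))) ⟩
  ∑ (interval 1 (suc K)) (K ∸_)                             ≡⟨ ∑-interval-∸ K ⟩
  K C 2                                                      ∎

∑-pairs-straddling : ∀ {K i} (f g : ℕ → ℕ) → i < K →
  ∑ (pairs K) (λ ab → (bit (proj₁ ab ≤ᵇ i) * f (proj₁ ab)) * (bit (i <ᵇ proj₂ ab) * g (proj₂ ab)))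
    ≡ ∑ (interval 1 (suc i)) f * ∑ (interval (suc i) (suc K)) g
∑-pairs-straddling {K} {i} f g i<K = begin
  ∑ (pairs K) (λ ab → (bit (proj₁ ab ≤ᵇ i) * f (proj₁ ab)) * (bit (i <ᵇ proj₂ ab) * g (proj₂ ab)))
    ≡⟨ ∑-pairs K _ ⟩
  ∑ (interval 1 (suc K)) (λ a → ∑ (interval (suc a) (suc K)) (λ b → F a * G b))
    ≡⟨ ∑-cong (interval 1 (suc K)) (λ {a} _ → ∑-*ˡ (interval (suc a) (suc K)) (F a) G) ⟨
  ∑ (interval 1 (suc K)) (λ a → F a * ∑ (interval (suc a) (suc K)) G)
    ≡⟨ ∑-interval-vanishʳ (s≤s z≤n) (s≤s (<⇒≤ i<K)) _ (λ {a} i<a _ → cong (_* ∑ (interval (suc a) (suc K)) G) (F≡0 i<a)) ⟩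
  ∑ (interval 1 (suc i)) (λ a → F a * ∑ (interval (suc a) (suc K)) G)
    ≡⟨ ∑-interval-cong 1 (suc i) (λ _ a≤i → cong₂ _*_ (F≡f (≤-pred a≤i)) (∑G≡∑g (≤-pred a≤i))) ⟩
  ∑ (interval 1 (suc i)) (λ a → f a * ∑ (interval (suc i) (suc K)) g)
    ≡⟨ ∑-*ʳ (interval 1 (suc i)) (∑ (interval (suc i) (suc K)) g) f ⟨
  ∑ (interval 1 (suc i)) f * ∑ (interval (suc i) (suc K)) g
    ∎
  where
  F G : ℕ → ℕ
  F a = bit (a ≤ᵇ i) * f a
  G b = bit (i <ᵇ b) * g b
  F≡0 : ∀ {a} → i < a → F a ≡ 0
  F≡0 {a} i<a = cong (_* f a) (bit-¬T (<⇒≱ i<a ∘ ≤ᵇ⇒≤ a i))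
  F≡f : ∀ {a} → a ≤ i → F a ≡ f a
  F≡f a≤i = trans (cong (_* f _) (bit-T (≤⇒≤ᵇ a≤i))) (*-identityˡ _)
  ∑G≡∑g : ∀ {a} → a ≤ i → ∑ (interval (suc a) (suc K)) G ≡ ∑ (interval (suc i) (suc K)) g
  ∑G≡∑g {a} a≤i = begin
    ∑ (interval (suc a) (suc K)) G
      ≡⟨ ∑-interval-vanishˡ (s≤s a≤i) (s≤s (<⇒≤ i<K)) G (λ _ b≤i → cong (_* g _) (bit-¬T (<⇒≱ b≤i ∘ <ᵇ⇒< i _))) ⟩
    ∑ (interval (suc i) (suc K)) G
      ≡⟨ ∑-interval-cong (suc i) (suc K) (λ i<b _ → trans (cong (_* g _) (bit-T (<⇒<ᵇ i<b))) (*-identityˡ _)) ⟩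
    ∑ (interval (suc i) (suc K)) g  ∎

T-upward : ∀ (P : ℕ → Bool) → (∀ {x} → T (P x) → T (P (suc x))) → T (P a) → a ≤ x → T (P x)
T-upward {a} P up Pa a≤x = go (≤⇒≤′ a≤x)
  where
  go : ∀ {x} → a ≤′ x → T (P x)
  go ≤′-refl        = Pa
  go (≤′-step a≤′x) = up (go a≤′x)

T-downward : ∀ (P : ℕ → Bool) → (∀ {x} → T (P (suc x)) → T (P x)) → T (P b) → x ≤ b → T (P x)
T-downward {b} {x} P down Pb x≤b = go (≤⇒≤′ x≤b) Pb
  where
  go : ∀ {b} → x ≤′ b → T (P b) → T (P x)
  go ≤′-refl        Pb = Pb
  go (≤′-step x≤′b) Pb = go x≤′b (down Pb)

-- The form in which the no-gap condition is used: if everything strictly between s and c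
-- lies below s, then there is no gap between s and c.
LocallyComparable : (ℕ → ℕ → Bool) → ℕ → ℕ → Set
LocallyComparable lt lo hi = ∀ {s c} → lo ≤ s → s < c → c < hi →
  (∀ {k} → s < k → k < c → T (lt k s)) → T (lt s c) ⊎ T (lt c s)

module StrictMax (lt : ℕ → ℕ → Bool)
  (lt-trans : ∀ {x y z} → T (lt x y) → T (lt y z) → T (lt x z))
  (lt-irrefl : ∀ {x} → ¬ T (lt x x)) where

  IsStrictMaxOn : ℕ → ℕ → ℕ → Set
  IsStrictMaxOn a b i = a ≤ i × i < b × (∀ {k} → a ≤ k → k < b → k ≢ i → T (lt k i))

  lt-asym : ∀ {x y} → T (lt x y) → ¬ T (lt y x)
  lt-asym x<y y<x = lt-irrefl (lt-trans x<y y<x)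

  strictMax-unique : ∀ {a b i j} → IsStrictMaxOn a b i → IsStrictMaxOn a b j → i ≡ j
  strictMax-unique {i = i} {j} (a≤i , i<b , i-max) (a≤j , j<b , j-max) with i ≟ j
  ... | yes i≡j = i≡j
  ... | no  i≢j = ⊥-elim (lt-asym (j-max a≤i i<b i≢j) (i-max a≤j j<b (i≢j ∘ sym)))

  argmax : ℕ → ℕ → ℕ
  argmax a zero = a
  argmax a (suc c) with a <? c
  ... | no  _ = a
  ... | yes _ = if lt (argmax a c) c then c else argmax a c

  peak : ℕ × ℕ → ℕ
  peak (a , b) = argmax a b

  argmax-strictMax : ∀ {lo hi} → LocallyComparable lt lo hi →
    ∀ {a b} → lo ≤ a → a < b → b ≤ hi → IsStrictMaxOn a b (argmax a b)
  argmax-strictMax lc {a} {suc c} lo≤a a<b b≤hi with a <? c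
  ... | no a≮c = ≤-refl , a<b , λ a≤k k<b k≢a → ⊥-elim (k≢a (≤-antisym (≤-trans (≤-pred k<b) (≮⇒≥ a≮c)) a≤k))
  ... | yes a<c with argmax-strictMax lc lo≤a a<c (<⇒≤ b≤hi)
  ...   | a≤s , s<c , s-max with lt (argmax a c) c in s<c?
  ...     | true = <⇒≤ a<c , ≤-refl , c-max
    where
    c-max : ∀ {k} → a ≤ k → k < suc c → k ≢ c → T (lt k c)
    c-max {k} a≤k k≤c k≢c with k ≟ argmax a c
    ... | yes refl = Equivalence.from T-≡ s<c?
    ... | no k≢s   = lt-trans (s-max a≤k (≤∧≢⇒< (≤-pred k≤c) k≢c) k≢s) (Equivalence.from T-≡ s<c?)
  ...     | false = a≤s , m<n⇒m<1+n s<c , s-max′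
    where
    c<s : T (lt c (argmax a c))
    c<s with lc (≤-trans lo≤a a≤s) s<c b≤hi (λ s<k k<c → s-max (≤-trans a≤s (<⇒≤ s<k)) k<c (>⇒≢ s<k))
    ... | inj₁ s<c′ = ⊥-elim (subst T s<c? s<c′)
    ... | inj₂ c<s′ = c<s′
    s-max′ : ∀ {k} → a ≤ k → k < suc c → k ≢ argmax a c → T (lt k (argmax a c))
    s-max′ {k} a≤k k≤c k≢s with k ≟ c
    ... | yes refl = c<s
    ... | no k≢c   = s-max a≤k (≤∧≢⇒< (≤-pred k≤c) k≢c) k≢s

module Coordinates {m' n' : ℕ} (R : Rel m' n') where

  ltB⇒≺ : ∀ {x y} → T (ltB R x y) → _≺_ R x y
  ltB⇒≺ {x} {y} x<y with R x y | R y x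
  ltB⇒≺ x<y | true  | false = _ , λ ()
  ltB⇒≺ () | true  | true
  ltB⇒≺ () | false | _

  ≺⇒ltB : ∀ {x y} → _≺_ R x y → T (ltB R x y)
  ≺⇒ltB {x} {y} x≺y with R x y | R y x
  ≺⇒ltB x≺y | true  | false = _
  ≺⇒ltB x≺y | true  | true  = proj₂ x≺y _
  ≺⇒ltB x≺y | false | _     = proj₁ x≺y

  ltM-trans : IsPreorder R → ∀ {u v w} → T (ltM R u v) → T (ltM R v w) → T (ltM R u w)
  ltM-trans (_ , ≼-trans) {just x} {just y} {just z} x<y y<z with ltB⇒≺ x<y | ltB⇒≺ y<z
  ... | x≼y , y⋠x | y≼z , _ = ≺⇒ltB (≼-trans x y z x≼y y≼z , λ z≼x → y⋠x (≼-trans y z x y≼z z≼x))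

  ltM-irrefl : ∀ {u} → ¬ T (ltM R u u)
  ltM-irrefl {just x} x<x = proj₂ (ltB⇒≺ x<x) (proj₁ (ltB⇒≺ x<x))

  firstOr-∷-T : ∀ (P : ℕ → Bool) d {x} xs → T (P x) → firstOr R P d (x ∷ xs) ≡ x
  firstOr-∷-T P d {x} xs Px with P x
  ... | true = refl

  firstOr-∷-¬T : ∀ (P : ℕ → Bool) d {x} xs → ¬ T (P x) → firstOr R P d (x ∷ xs) ≡ firstOr R P d xs
  firstOr-∷-¬T P d {x} xs ¬Px with P x
  ... | true  = ⊥-elim (¬Px _)
  ... | false = refl

  -- Defs.coord finds W₁ and W₂ as the threshold of a monotone predicate; the distance to the
  -- threshold is the number of indices satisfying it.
  firstOr-upward : ∀ (P : ℕ → Bool) → (∀ {x} → T (P x) → T (P (suc x))) → ∀ {lo hi} → lo ≤ hi → T (P hi) →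
    hi ∸ firstOr R P hi (interval lo (suc hi)) + 1 ≡ count P (interval lo (suc hi))
  firstOr-upward P up {lo} {hi} lo≤hi Phi = go (≤⇒≤‴ lo≤hi)
    where
    go : ∀ {lo} → lo ≤‴ hi → hi ∸ firstOr R P hi (interval lo (suc hi)) + 1 ≡ count P (interval lo (suc hi))
    go {lo} lo≤‴hi with T? (P lo)
    ... | yes Plo = begin
      hi ∸ firstOr R P hi (interval lo (suc hi)) + 1
        ≡⟨ cong (λ xs → hi ∸ firstOr R P hi xs + 1) (interval-∷ (s≤s lo≤hi′)) ⟩
      hi ∸ firstOr R P hi (lo ∷ interval (suc lo) (suc hi)) + 1
        ≡⟨ cong (λ z → hi ∸ z + 1) (firstOr-∷-T P hi (interval (suc lo) (suc hi)) Plo) ⟩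
      hi ∸ lo + 1                        ≡⟨ +-∸-comm 1 lo≤hi′ ⟨
      hi + 1 ∸ lo                        ≡⟨ cong (_∸ lo) (+-comm hi 1) ⟩
      suc hi ∸ lo                        ≡⟨ length-interval lo (suc hi) ⟨
      length (interval lo (suc hi))
        ≡⟨ count-all P (interval lo (suc hi)) (All.tabulate (λ x∈ → T-upward P up Plo (proj₁ (∈-interval⁻ x∈)))) ⟨
      count P (interval lo (suc hi))     ∎
      where
      lo≤hi′ : lo ≤ hi
      lo≤hi′ = ≤‴⇒≤ lo≤‴hi
    go {lo} ≤‴-refl          | no ¬Plo = ⊥-elim (¬Plo Phi)
    go {lo} (≤‴-step lo<‴hi) | no ¬Plo = begin
      hi ∸ firstOr R P hi (interval lo (suc hi)) + 1
        ≡⟨ cong (λ xs → hi ∸ firstOr R P hi xs + 1) (interval-∷ (s≤s (≤‴⇒≤ (≤‴-step lo<‴hi)))) ⟩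
      hi ∸ firstOr R P hi (lo ∷ interval (suc lo) (suc hi)) + 1
        ≡⟨ cong (λ z → hi ∸ z + 1) (firstOr-∷-¬T P hi (interval (suc lo) (suc hi)) ¬Plo) ⟩
      hi ∸ firstOr R P hi (interval (suc lo) (suc hi)) + 1
        ≡⟨ go lo<‴hi ⟩
      count P (interval (suc lo) (suc hi))
        ≡⟨ cong (_+ count P (interval (suc lo) (suc hi))) (bit-¬T ¬Plo) ⟨
      count P (lo ∷ interval (suc lo) (suc hi))
        ≡⟨ cong (count P) (interval-∷ (s≤s (≤‴⇒≤ (≤‴-step lo<‴hi)))) ⟨
      count P (interval lo (suc hi))
        ∎

  firstOr-downward : ∀ (P : ℕ → Bool) → (∀ {x} → T (P (suc x)) → T (P x)) → ∀ {i hi} → i < hi → T (P (suc i)) →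
    firstOr R P (suc i) (reverse (interval (suc i) (suc hi))) ∸ i ≡ count P (interval (suc i) (suc hi))
  firstOr-downward P down {i} {suc h} i<hi Pi with m≤n⇒m<n∨m≡n (≤-pred i<hi)
  ... | inj₂ refl = begin
    firstOr R P (suc i) (reverse (interval (suc i) (2 + i))) ∸ i
      ≡⟨ cong (λ xs → firstOr R P (suc i) (reverse xs) ∸ i) (interval-singleton (suc i)) ⟩
    firstOr R P (suc i) [ suc i ] ∸ i                              ≡⟨ cong (_∸ i) (firstOr-∷-T P (suc i) [] Pi) ⟩
    suc i ∸ i                                                      ≡⟨ m+n∸n≡m 1 i ⟩
    1                                                              ≡⟨ count-all P [ suc i ] (Pi All.∷ All.[]) ⟨
    count P [ suc i ]                                              ≡⟨ cong (count P) (interval-singleton (suc i)) ⟨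
    count P (interval (suc i) (2 + i))                             ∎
  ... | inj₁ i<h with T? (P (suc h))
  ...   | yes Ph = begin
    firstOr R P (suc i) (reverse (interval (suc i) (2 + h))) ∸ i
      ≡⟨ cong (λ xs → firstOr R P (suc i) xs ∸ i) (reverse-interval (s≤s (<⇒≤ i<h))) ⟩
    firstOr R P (suc i) (suc h ∷ reverse (interval (suc i) (suc h))) ∸ i
      ≡⟨ cong (_∸ i) (firstOr-∷-T P (suc i) (reverse (interval (suc i) (suc h))) Ph) ⟩
    suc h ∸ i
      ≡⟨ length-interval (suc i) (2 + h) ⟨
    length (interval (suc i) (2 + h))
      ≡⟨ count-all P (interval (suc i) (2 + h)) (All.tabulate (λ x∈ → T-downward P down Ph (≤-pred (proj₂ (∈-interval⁻ x∈))))) ⟨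
    count P (interval (suc i) (2 + h))
      ∎
  ...   | no ¬Ph = begin
    firstOr R P (suc i) (reverse (interval (suc i) (2 + h))) ∸ i
      ≡⟨ cong (λ xs → firstOr R P (suc i) xs ∸ i) (reverse-interval (s≤s (<⇒≤ i<h))) ⟩
    firstOr R P (suc i) (suc h ∷ reverse (interval (suc i) (suc h))) ∸ i
      ≡⟨ cong (_∸ i) (firstOr-∷-¬T P (suc i) (reverse (interval (suc i) (suc h))) ¬Ph) ⟩
    firstOr R P (suc i) (reverse (interval (suc i) (suc h))) ∸ i
      ≡⟨ firstOr-downward P down i<h Pi ⟩
    count P (interval (suc i) (suc h))
      ≡⟨ +-identityʳ _ ⟨
    count P (interval (suc i) (suc h)) + 0
      ≡⟨ cong (λ z → count P (interval (suc i) (suc h)) + (z + 0)) (bit-¬T ¬Ph) ⟨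
    count P (interval (suc i) (suc h)) + count P [ suc h ]
      ≡⟨ ∑-++ (interval (suc i) (suc h)) [ suc h ] (bit ∘ P) ⟨
    count P (interval (suc i) (suc h) ∷ʳ suc h)
      ≡⟨ cong (count P) (interval-∷ʳ (s≤s (<⇒≤ i<h))) ⟨
    count P (interval (suc i) (2 + h))
      ∎

  module Side (pre : IsPreorder R) (par orth : ℕ → Maybe (Coll m' n')) (B A : ℕ) where

    _⊏_ _⊏ₒ_ : ℕ → ℕ → Bool
    k ⊏ i  = ltM R (par k) (par i)
    k ⊏ₒ j = ltM R (orth k) (orth j)

    module Par  = StrictMax _⊏_  (λ {x y z} → ltM-trans pre {par x} {par y} {par z}) (λ {x} → ltM-irrefl {par x})
    module Orth = StrictMax _⊏ₒ_ (λ {x y z} → ltM-trans pre {orth x} {orth y} {orth z}) (λ {x} → ltM-irrefl {orth x})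

    dominatesLeft dominatesRight : ℕ → ℕ → Bool
    dominatesLeft  i a = all (_⊏ i) (interval a i)
    dominatesRight i b = all (_⊏ i) (interval (suc i) b)

    isPeak : ℕ × ℕ → ℕ → Bool
    isPeak (a , b) i = ((a ≤ᵇ i) ∧ dominatesLeft i a) ∧ ((i <ᵇ b) ∧ dominatesRight i b)

    coversOrth : ℕ → ℕ × ℕ → Bool
    coversOrth i (a , b) = all (λ k → ltM R (orth k) (par i)) (interval a b)

    weight : ℕ → ℕ
    weight i = 1 + length (filter (λ J → coversOrth i J Bool.≟ true) (pairs (suc A)))

    -- W₁ counts the left ends a, and W₂ the right ends b, of the intervals [a, b) whose strict
    -- maximum is i.
    coord≡peaks : ∀ {i} → 1 ≤ i → i ≤ B →
      coord R par (suc B) orth (suc A) i ≡ ∑ (pairs (suc B)) (λ I → bit (isPeak I i)) * weight i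
    coord≡peaks {i} 1≤i i≤B = cong (_* weight i) (begin
      (i ∸ firstOr R (dominatesLeft i) i (interval 1 (suc i)) + 1)
        * (firstOr R (dominatesRight i) (suc i) (reverse (interval (suc i) (2 + B))) ∸ i)
          ≡⟨ cong₂ _*_ (firstOr-upward (dominatesLeft i) left-up 1≤i left-full)
                       (firstOr-downward (dominatesRight i) right-down (s≤s i≤B) right-full) ⟩
      count (dominatesLeft i) (interval 1 (suc i)) * count (dominatesRight i) (interval (suc i) (2 + B))
          ≡⟨ ∑-pairs-straddling (bit ∘ dominatesLeft i) (bit ∘ dominatesRight i) (s≤s i≤B) ⟨
      ∑ (pairs (suc B)) (λ ab → (bit (proj₁ ab ≤ᵇ i) * bit (dominatesLeft i (proj₁ ab)))
                                 * (bit (i <ᵇ proj₂ ab) * bit (dominatesRight i (proj₂ ab))))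
          ≡⟨ ∑-cong (pairs (suc B)) (λ {ab} _ → bit-isPeak ab) ⟨
      ∑ (pairs (suc B)) (λ I → bit (isPeak I i)) ∎)
      where
      left-up : ∀ {a} → T (dominatesLeft i a) → T (dominatesLeft i (suc a))
      left-up {a} dom = all-interval⁻ (_⊏ i) (suc a) i (λ a<x x<i → all-interval⁺ (_⊏ i) a i dom (<⇒≤ a<x) x<i)
      left-full : T (dominatesLeft i i)
      left-full = all-interval⁻ (_⊏ i) i i (λ i≤x x<i → ⊥-elim (<⇒≱ x<i i≤x))
      right-down : ∀ {b} → T (dominatesRight i (suc b)) → T (dominatesRight i b)
      right-down {b} dom =
        all-interval⁻ (_⊏ i) (suc i) b (λ i<x x<b → all-interval⁺ (_⊏ i) (suc i) (suc b) dom i<x (m<n⇒m<1+n x<b))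
      right-full : T (dominatesRight i (suc i))
      right-full = all-interval⁻ (_⊏ i) (suc i) (suc i) (λ i<x x≤i → ⊥-elim (<⇒≱ i<x (≤-pred x≤i)))
      bit-isPeak : ∀ ab → bit (isPeak ab i) ≡ (bit (proj₁ ab ≤ᵇ i) * bit (dominatesLeft i (proj₁ ab)))
                                              * (bit (i <ᵇ proj₂ ab) * bit (dominatesRight i (proj₂ ab)))
      bit-isPeak (a , b) = begin
        bit (isPeak (a , b) i)
          ≡⟨ bit-∧ ((a ≤ᵇ i) ∧ dominatesLeft i a) ((i <ᵇ b) ∧ dominatesRight i b) ⟩
        bit ((a ≤ᵇ i) ∧ dominatesLeft i a) * bit ((i <ᵇ b) ∧ dominatesRight i b)
          ≡⟨ cong₂ _*_ (bit-∧ (a ≤ᵇ i) (dominatesLeft i a)) (bit-∧ (i <ᵇ b) (dominatesRight i b)) ⟩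
        (bit (a ≤ᵇ i) * bit (dominatesLeft i a)) * (bit (i <ᵇ b) * bit (dominatesRight i b)) ∎

    isPeak⇒strictMax : ∀ {a b i} → T (isPeak (a , b) i) → Par.IsStrictMaxOn a b i
    isPeak⇒strictMax {a} {b} {i} peak-i = ≤ᵇ⇒≤ a i (proj₁ left) , <ᵇ⇒< i b (proj₁ right) , below-i
      where
      halves : T ((a ≤ᵇ i) ∧ dominatesLeft i a) × T ((i <ᵇ b) ∧ dominatesRight i b)
      halves = Equivalence.to T-∧ peak-i
      left : T (a ≤ᵇ i) × T (dominatesLeft i a)
      left = Equivalence.to T-∧ (proj₁ halves)
      right : T (i <ᵇ b) × T (dominatesRight i b)
      right = Equivalence.to T-∧ (proj₂ halves)
      below-i : ∀ {k} → a ≤ k → k < b → k ≢ i → T (k ⊏ i)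
      below-i {k} a≤k k<b k≢i with <-cmp k i
      ... | tri< k<i _ _ = all-interval⁺ (_⊏ i) a i (proj₂ left) a≤k k<i
      ... | tri≈ _ k≡i _ = ⊥-elim (k≢i k≡i)
      ... | tri> _ _ i<k = all-interval⁺ (_⊏ i) (suc i) b (proj₂ right) i<k k<b

    strictMax⇒isPeak : ∀ {a b i} → Par.IsStrictMaxOn a b i → T (isPeak (a , b) i)
    strictMax⇒isPeak {a} {b} {i} (a≤i , i<b , below-i) = Equivalence.from T-∧
      ( Equivalence.from T-∧ (≤⇒≤ᵇ a≤i , all-interval⁻ (_⊏ i) a i left)
      , Equivalence.from T-∧ (<⇒<ᵇ i<b , all-interval⁻ (_⊏ i) (suc i) b right))
      where
      left : ∀ {k} → a ≤ k → k < i → T (k ⊏ i)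
      left a≤k k<i = below-i a≤k (<-trans k<i i<b) (<⇒≢ k<i)
      right : ∀ {k} → suc i ≤ k → k < b → T (k ⊏ i)
      right i<k k<b = below-i (≤-trans a≤i (<⇒≤ i<k)) k<b (>⇒≢ i<k)

    ∑-at-peak : ∀ {a b i₀} → 1 ≤ a → b ≤ suc B → Par.IsStrictMaxOn a b i₀ → (h : ℕ → ℕ) →
      ∑ (interval 1 (suc B)) (λ i → bit (isPeak (a , b) i) * h i) ≡ h i₀
    ∑-at-peak {a} {b} {i₀} 1≤a b≤N i₀-max@(a≤i₀ , i₀<b , _) h = begin
      ∑ (interval 1 (suc B)) (λ i → bit (isPeak (a , b) i) * h i)
        ≡⟨ ∑-interval-single (≤-trans 1≤a a≤i₀) (<-≤-trans i₀<b b≤N) _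
             (λ _ _ i≢i₀ → cong (_* h _) (bit-¬T (i≢i₀ ∘ not-peak))) ⟩
      bit (isPeak (a , b) i₀) * h i₀  ≡⟨ cong (_* h i₀) (bit-T (strictMax⇒isPeak i₀-max)) ⟩
      1 * h i₀                        ≡⟨ *-identityˡ (h i₀) ⟩
      h i₀                            ∎
      where
      not-peak : ∀ {i} → T (isPeak (a , b) i) → i ≡ i₀
      not-peak peak-i = Par.strictMax-unique (isPeak⇒strictMax peak-i) i₀-max

    coversOrth-peak : ∀ {a b j i} → Orth.IsStrictMaxOn a b j → bit (coversOrth i (a , b)) ≡ bit (ltM R (orth j) (par i))
    coversOrth-peak {a} {b} {j} {i} (a≤j , j<b , below-j) = bit-cong
      (λ covers → all-interval⁺ (λ k → ltM R (orth k) (par i)) a b covers a≤j j<b)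
      (λ j<i → all-interval⁻ (λ k → ltM R (orth k) (par i)) a b (λ {k} a≤k k<b → below-peak j<i a≤k k<b))
      where
      below-peak : T (ltM R (orth j) (par i)) → ∀ {k} → a ≤ k → k < b → T (ltM R (orth k) (par i))
      below-peak j<i {k} a≤k k<b with k ≟ j
      ... | yes refl = j<i
      ... | no k≢j   = ltM-trans pre {orth k} (below-j a≤k k<b k≢j) j<i

    peak-bounds : LocallyComparable _⊏_ 1 (suc B) → ∀ {I} → I ∈ pairs (suc B) → 1 ≤ Par.peak I × Par.peak I ≤ B
    peak-bounds par-lc I∈ =
      let 1≤a , a<b , b≤N = ∈-pairs⁻ I∈
          a≤i , i<b , _   = Par.argmax-strictMax par-lc 1≤a a<b b≤N
      in ≤-trans 1≤a a≤i , ≤-pred (<-≤-trans i<b b≤N)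

    sideSum : LocallyComparable _⊏_ 1 (suc B) → LocallyComparable _⊏ₒ_ 1 (suc A) →
      ∑ (interval 1 (suc B)) (coord R par (suc B) orth (suc A))
        ≡ ∑ (pairs (suc B)) (λ I → 1 + ∑ (pairs (suc A)) (λ J → bit (ltM R (orth (Orth.peak J)) (par (Par.peak I)))))
    sideSum par-lc orth-lc = begin
      ∑ (interval 1 (suc B)) (coord R par (suc B) orth (suc A))
        ≡⟨ ∑-interval-cong 1 (suc B) (λ 1≤i i≤B → coord≡peaks 1≤i (≤-pred i≤B)) ⟩
      ∑ (interval 1 (suc B)) (λ i → ∑ (pairs (suc B)) (λ I → bit (isPeak I i)) * weight i)
        ≡⟨ ∑-cong (interval 1 (suc B)) (λ {i} _ → ∑-*ʳ (pairs (suc B)) (weight i) (λ I → bit (isPeak I i))) ⟩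
      ∑ (interval 1 (suc B)) (λ i → ∑ (pairs (suc B)) (λ I → bit (isPeak I i) * weight i))
        ≡⟨ ∑-comm (interval 1 (suc B)) (pairs (suc B)) (λ i I → bit (isPeak I i) * weight i) ⟩
      ∑ (pairs (suc B)) (λ I → ∑ (interval 1 (suc B)) (λ i → bit (isPeak I i) * weight i))
        ≡⟨ ∑-pairs-cong (suc B) (λ 1≤a a<b b≤N → ∑-at-peak 1≤a b≤N (Par.argmax-strictMax par-lc 1≤a a<b b≤N) weight) ⟩
      ∑ (pairs (suc B)) (λ I → weight (Par.peak I))
        ≡⟨ ∑-cong (pairs (suc B)) (λ {I} _ → cong suc (length-filter (coversOrth (Par.peak I)) (pairs (suc A)))) ⟩
      ∑ (pairs (suc B)) (λ I → 1 + ∑ (pairs (suc A)) (λ J → bit (coversOrth (Par.peak I) J)))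
        ≡⟨ ∑-cong (pairs (suc B)) (λ {I} _ → cong suc (∑-pairs-cong (suc A)
             (λ 1≤a a<b b≤M → coversOrth-peak (Orth.argmax-strictMax orth-lc 1≤a a<b b≤M)))) ⟩
      ∑ (pairs (suc B)) (λ I → 1 + ∑ (pairs (suc A)) (λ J → bit (ltM R (orth (Orth.peak J)) (par (Par.peak I)))))
        ∎

  fin1-suc : ∀ {K j} (j<K : j < K) → fin1 R K (suc j) ≡ just (fromℕ< j<K)
  fin1-suc {K} {j} j<K with j <? K
  ... | yes _   = refl
  ... | no j≮K = ⊥-elim (j≮K j<K)

  module Vertex (V : IsVertex R) where

    pre : IsPreorder R
    pre = proj₁ (proj₁ V)

    orthogonal-comparable : ∀ (j : Fin m') (i : Fin n') → Comparable R (inj₁ j) (inj₂ i)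
    orthogonal-comparable = proj₁ (proj₂ (proj₁ V))

    vertical-condition : ∀ (i j : Fin m') → Comparable R (inj₁ i) (inj₁ j) ⇔ (VLink R i j ⊎ ¬ VGap R i j)
    vertical-condition = proj₁ (proj₂ (proj₂ (proj₁ V)))

    horizontal-condition : ∀ (i j : Fin n') → Comparable R (inj₂ i) (inj₂ j) ⇔ (HLink R i j ⊎ ¬ HGap R i j)
    horizontal-condition = proj₂ (proj₂ (proj₂ (proj₁ V)))

    ≺-irrefl : ∀ {x} → ¬ _≺_ R x x
    ≺-irrefl (x≼x , x⋠x) = x⋠x x≼x

    ≺-asym : ∀ {x y} → _≺_ R x y → ¬ _≺_ R y x
    ≺-asym (x≼y , _) (_ , x⋠y) = x⋠y x≼y

    comparable⇒ltB : ∀ {x y} → x ≢ y → Comparable R x y → T (ltB R x y) ⊎ T (ltB R y x)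
    comparable⇒ltB {x} {y} x≢y (inj₁ x≼y) = inj₁ (≺⇒ltB (x≼y , λ y≼x → x≢y (proj₂ V x y x≼y y≼x)))
    comparable⇒ltB {x} {y} x≢y (inj₂ y≼x) = inj₂ (≺⇒ltB (y≼x , λ x≼y → x≢y (proj₂ V x y x≼y y≼x)))

    module Family {K} (emb : Fin K → Coll m' n') (emb-injective : ∀ {i j} → emb i ≡ emb j → i ≡ j)
      (no-gap⇒comparable : ∀ i j → ¬ (∃[ t ] (Between R i j t × _≺_ R (emb i) (emb t) × _≺_ R (emb j) (emb t))) →
                           Comparable R (emb i) (emb j)) where

      line : ℕ → Maybe (Coll m' n')
      line k = Maybe.map emb (fin1 R K k)

      line-suc : ∀ {j} (j<K : j < K) → line (suc j) ≡ just (emb (fromℕ< j<K))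
      line-suc j<K = cong (Maybe.map emb) (fin1-suc j<K)

      line-toℕ : ∀ (t : Fin K) → line (suc (toℕ t)) ≡ just (emb t)
      line-toℕ t = trans (line-suc (toℕ<n t)) (cong (just ∘ emb) (fromℕ<-toℕ t (toℕ<n t)))

      locallyComparable : LocallyComparable (λ k i → ltM R (line k) (line i)) 1 (suc K)
      locallyComparable {suc s} {suc c} _ (s≤s s<c) (s≤s c<K) below-s =
        Sum.map (from-ltB (<-trans s<c c<K) c<K) (from-ltB c<K (<-trans s<c c<K))
          (comparable⇒ltB (λ eq → <⇒≢ s<c (trans (sym toℕ-s) (trans (cong toℕ (emb-injective eq)) toℕ-c)))
                          (no-gap⇒comparable fs fc no-gap))
        where
        from-ltB : ∀ {u v} (u<K : u < K) (v<K : v < K) →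
          T (ltB R (emb (fromℕ< u<K)) (emb (fromℕ< v<K))) → T (ltM R (line (suc u)) (line (suc v)))
        from-ltB u<K v<K = subst₂ (λ x y → T (ltM R x y)) (sym (line-suc u<K)) (sym (line-suc v<K))
        fs fc : Fin K
        fs = fromℕ< (<-trans s<c c<K)
        fc = fromℕ< c<K
        toℕ-s : toℕ fs ≡ s
        toℕ-s = toℕ-fromℕ< (<-trans s<c c<K)
        toℕ-c : toℕ fc ≡ c
        toℕ-c = toℕ-fromℕ< c<K
        no-gap : ¬ (∃[ t ] (Between R fs fc t × _≺_ R (emb fs) (emb t) × _≺_ R (emb fc) (emb t)))
        no-gap (t , inj₂ (c≤t , t≤s) , _) =
          <⇒≱ s<c (subst₂ _≤_ toℕ-c toℕ-s (≤-trans c≤t t≤s))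
        no-gap (t , inj₁ (s≤t , t≤c) , fs≺t , fc≺t) with toℕ t ≟ s | toℕ t ≟ c
        ... | yes t≡s | _ = ≺-irrefl (subst (λ u → _≺_ R (emb u) (emb t)) (toℕ-injective (trans toℕ-s (sym t≡s))) fs≺t)
        ... | no _ | yes t≡c = ≺-irrefl (subst (λ u → _≺_ R (emb u) (emb t)) (toℕ-injective (trans toℕ-c (sym t≡c))) fc≺t)
        ... | no t≢s | no t≢c = ≺-asym fs≺t (ltB⇒≺ t<s)
          where
          t<s : T (ltB R (emb t) (emb fs))
          t<s = subst₂ (λ u v → T (ltM R u v)) (line-toℕ t) (line-suc (<-trans s<c c<K))
                  (below-s (s≤s (≤∧≢⇒< (subst (_≤ toℕ t) toℕ-s s≤t) (t≢s ∘ sym)))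
                           (s≤s (≤∧≢⇒< (subst (toℕ t ≤_) toℕ-c t≤c) t≢c)))

    orthogonal-exclusive : ∀ {i j} → 1 ≤ i → i ≤ n' → 1 ≤ j → j ≤ m' →
      bit (ltM R (horiz R i) (vert R j)) + bit (ltM R (vert R j) (horiz R i)) ≡ 1
    orthogonal-exclusive {suc i} {suc j} _ i<n _ j<m =
      bit-exclusive
        (subst₂ (λ h v → T (ltM R h v) ⊎ T (ltM R v h)) (sym horiz-suc) (sym vert-suc)
          (Sum.swap (comparable⇒ltB (λ ()) (orthogonal-comparable (fromℕ< j<m) (fromℕ< i<n)))))
        (λ (h<v , v<h) → ltM-irrefl {horiz R (suc i)} (ltM-trans pre {horiz R (suc i)} h<v v<h))
      where
      horiz-suc : horiz R (suc i) ≡ just (inj₂ (fromℕ< i<n))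
      horiz-suc = cong (Maybe.map inj₂) (fin1-suc i<n)
      vert-suc : vert R (suc j) ≡ just (inj₁ (fromℕ< j<m))
      vert-suc = cong (Maybe.map inj₁) (fin1-suc j<m)

    module Vert  = Family inj₁ inj₁-injective (λ i j ¬gap → Equivalence.from (vertical-condition i j) (inj₂ ¬gap))
    module Horiz = Family inj₂ inj₂-injective (λ i j ¬gap → Equivalence.from (horizontal-condition i j) (inj₂ ¬gap))
    module X = Side pre (vert R) (horiz R) m' n'
    module Y = Side pre (horiz R) (vert R) n' m'

mainTheorem13 : (m' n' : ℕ) (R : Rel m' n') → IsVertex R →
    coordSum R ≡ (suc n' C 2) * (suc m' C 2) + (suc n' C 2) + (suc m' C 2)
mainTheorem13 m' n' R V = begin
  coordSum R
    ≡⟨ cong₂ _+_ (X.sideSum Vert.locallyComparable Horiz.locallyComparable)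
                 (Y.sideSum Horiz.locallyComparable Vert.locallyComparable) ⟩
  ∑ (pairs (suc m')) (λ J → 1 + ∑ (pairs (suc n')) (λ I → bit (ltM R (horiz R (Y.Par.peak I)) (vert R (X.Par.peak J)))))
    + ∑ (pairs (suc n')) (λ I → 1 + ∑ (pairs (suc m')) (λ J → bit (ltM R (vert R (X.Par.peak J)) (horiz R (Y.Par.peak I)))))
    ≡⟨ ∑-complementary (pairs (suc n')) (pairs (suc m')) _ _ peaks-exclusive ⟩
  length (pairs (suc n')) * length (pairs (suc m')) + length (pairs (suc n')) + length (pairs (suc m'))
    ≡⟨ cong₂ (λ p q → p * q + p + q) (length-pairs (suc n')) (length-pairs (suc m')) ⟩
  (suc n' C 2) * (suc m' C 2) + (suc n' C 2) + (suc m' C 2) ∎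
  where
  open Coordinates R
  open Vertex V
  peaks-exclusive : ∀ {I J} → I ∈ pairs (suc n') → J ∈ pairs (suc m') →
    bit (ltM R (horiz R (Y.Par.peak I)) (vert R (X.Par.peak J))) + bit (ltM R (vert R (X.Par.peak J)) (horiz R (Y.Par.peak I))) ≡ 1
  peaks-exclusive I∈ J∈ =
    let 1≤i , i≤n = Y.peak-bounds Horiz.locallyComparable I∈
        1≤j , j≤m = X.peak-bounds Vert.locallyComparable J∈
    in orthogonal-exclusive 1≤i i≤n 1≤j j≤m
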